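{- For every integer $k\ge1$: (1) $T(2,2k;k)=\frac{k+1}{k}\,T(2,2k;k+1)$; (2) $T(2,2k;k)-T(2,2k;k+1)=\frac1k\,T(2,2k;k+1)$; (3) $T(2,2k;k)-T(2,2k;k+1)=T(2,2k-1;k)-T(2,2k-1;k+1)$.
   Context: For integers $n\ge0$ and $k\ge0$, $T(2,n;k)$ denotes the number of ways to select a set of $k$ squares from a $2\times n$ rectangular grid of unit squares ($2$ rows, $n$ columns) such that no two selected squares are horizontally or vertically adjacent (share an edge); $T(2,n;k)=0$ for $k>n$. -}

module Defs where

open import Data.Bool using (Bool; true; false; _∧_; not)
open import Data.Nat using (ℕ; zero; suc; _+_; _≡ᵇ_)
open import Data.List using (List; []; _∷_; map; filterᵇ; length; cartesianProduct; concatMap)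
open import Data.Vec using (Vec; []; _∷_)
open import Data.Product using (_×_; _,_)

-- A row of the 2×n grid is a Vec Bool n (true = square selected).
-- A selection of squares of the 2×n grid is a pair (top row, bottom row).

allRows : (n : ℕ) → List (Vec Bool n)
allRows zero    = [] ∷ []
allRows (suc n) = concatMap (λ v → (false ∷ v) ∷ (true ∷ v) ∷ []) (allRows n)

allSelections : (n : ℕ) → List (Vec Bool n × Vec Bool n)
allSelections n = cartesianProduct (allRows n) (allRows n)

noHorizAdj : {n : ℕ} → Vec Bool n → Bool
noHorizAdj []               = true
noHorizAdj (x ∷ [])         = true
noHorizAdj (x ∷ (y ∷ v))    = not (x ∧ y) ∧ noHorizAdj (y ∷ v)

noVertAdj : {n : ℕ} → Vec Bool n → Vec Bool n → Bool
noVertAdj []       []       = true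
noVertAdj (x ∷ u) (y ∷ v)  = not (x ∧ y) ∧ noVertAdj u v

count : {n : ℕ} → Vec Bool n → ℕ
count []            = 0
count (true ∷ v)    = suc (count v)
count (false ∷ v)   = count v

independent : {n : ℕ} → Vec Bool n × Vec Bool n → Bool
independent (t , b) = noHorizAdj t ∧ noHorizAdj b ∧ noVertAdj t b

size : {n : ℕ} → Vec Bool n × Vec Bool n → ℕ
size (t , b) = count t + count b

T2 : ℕ → ℕ → ℕ
T2 n k = length (filterᵇ (λ s → independent s ∧ (size s ≡ᵇ k)) (allSelections n))

module Submission where

-- Reading the 2 × n grid column by column (a transfer matrix),
-- let E n j = T(2, n; j) and let X n j count the j-element independent sets
-- of the 2 × n grid whose top-left square is forbidden.  Splitting off the
-- first column gives
--   E (n+1) (j+1) = E n (j+1) + 2 X n j,     X (n+1) (j+1) = E n (j+1) + X n j.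
-- These recurrences are solved in closed form by binomial sums:
--   X (a + b) a = D(a, b) = ∑ₗ 2ˡ (a choose l)(b choose l)   (Delannoy numbers),
--   E (c+1+b) (c+1) = G(c, b) = ∑ₗ 2ˡ⁺¹ (c choose l)(b+1 choose l+1).
-- Part (1) is then the identity (c+1) G(c, c+1) = (c+2) G(c+1, c), which
-- follows termwise from the absorption identity for binomial coefficients;
-- part (2) is a rearrangement of (1); and by the first recurrence, part (3)
-- says X(2k-1, k-1) = X(2k-1, k), i.e. the symmetry D(k-1, k) = D(k, k-1).

open import Defs
open import Data.Nat using (ℕ; suc; _+_; _*_; _∸_; _≤_; >-nonZero)
open import Data.Integer using (+_)
open import Data.Rational using (ℚ; _/_; _-_) renaming (_*_ to _*ℚ_)
open import Data.Product using (_×_)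
open import Relation.Binary.PropositionalEquality using (_≡_)

open import Data.Nat using (zero; _^_; _≡ᵇ_; NonZero; z≤n; s≤s)
open import Data.Nat.Properties using (+-suc; +-assoc; +-identityʳ; +-comm; *-zeroʳ; *-identityˡ; *-identityʳ; *-distribˡ-+; m≤m+n; n<1+n)
open import Data.Nat.Combinatorics using (_C_; nC1≡n; k>n⇒nCk≡0; nCk+nC[k+1]≡[n+1]C[k+1])
import Data.Nat.Tactic.RingSolver as ℕ-Solver
open import Data.Integer as ℤ using (ℤ)
open import Data.Integer.Properties using (pos-*; pos-+)
import Data.Integer.Tactic.RingSolver as ℤ-Solver
open import Data.Rational using (toℚᵘ; -_)
open import Data.Rational.Properties using (toℚᵘ-injective; toℚᵘ-fromℚᵘ; toℚᵘ-homo-*; toℚᵘ-homo-+; toℚᵘ-homo‿-)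
open import Data.Rational.Unnormalised as ℚᵘ using (mkℚᵘ; *≡*)
import Data.Rational.Unnormalised.Properties as ℚᵘ
open import Data.Bool using (Bool; true; false; _∧_; not)
open import Data.Bool.Properties using (∧-zeroʳ; ∧-commutativeMonoid)
open import Data.List using (List; []; _∷_; _++_; map; length; filterᵇ; concatMap; cartesianProduct)
open import Data.Vec using (Vec; []; _∷_)
open import Data.Product using (_,_; proj₁; proj₂)
open import Relation.Binary.PropositionalEquality using (refl; sym; trans; cong; cong₂; module ≡-Reasoning)
open import Algebra.Solver.CommutativeMonoid ∧-commutativeMonoid using (solve; _⊕_; _⊜_)
import Relation.Binary.Reasoning.Setoid as SetoidReasoning

-- Integer-valued rationals x / 1.  Equations between them reduce to integer
-- equations by cross-multiplication in the unnormalised rationals.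

module _ where
  open SetoidReasoning ℚᵘ.≃-setoid

  /1-scale : ∀ (x y m : ℤ) (k : ℕ) .{{_ : NonZero k}} → + k ℤ.* x ≡ m ℤ.* y →
             x / 1 ≡ (m / k) *ℚ (y / 1)
  /1-scale x y m (suc k) kx≡my = toℚᵘ-injective (begin
    toℚᵘ (x / 1)                         ≈⟨ toℚᵘ-fromℚᵘ (mkℚᵘ x 0) ⟩
    mkℚᵘ x 0                             ≈⟨ *≡* (cross-multiplied (+ suc k) x y m kx≡my) ⟩
    mkℚᵘ m k ℚᵘ.* mkℚᵘ y 0               ≈⟨ ℚᵘ.≃-sym (ℚᵘ.*-cong (toℚᵘ-fromℚᵘ (mkℚᵘ m k)) (toℚᵘ-fromℚᵘ (mkℚᵘ y 0))) ⟩
    toℚᵘ (m / suc k) ℚᵘ.* toℚᵘ (y / 1)   ≈⟨ ℚᵘ.≃-sym (toℚᵘ-homo-* (m / suc k) (y / 1)) ⟩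
    toℚᵘ ((m / suc k) *ℚ (y / 1))        ∎)
    where
    cross-multiplied : ∀ K x y m → K ℤ.* x ≡ m ℤ.* y → x ℤ.* (K ℤ.* + 1) ≡ (m ℤ.* y) ℤ.* + 1
    cross-multiplied K x y m Kx≡my = trans (unit-right x K) (trans Kx≡my (sym (unit-left m y)))
      where
      unit-right : ∀ x K → x ℤ.* (K ℤ.* + 1) ≡ K ℤ.* x
      unit-right = ℤ-Solver.solve-∀
      unit-left : ∀ m y → (m ℤ.* y) ℤ.* + 1 ≡ m ℤ.* y
      unit-left = ℤ-Solver.solve-∀

  /1-sub : ∀ (x y : ℤ) → x / 1 - y / 1 ≡ (x ℤ.- y) / 1
  /1-sub x y = toℚᵘ-injective (begin
    toℚᵘ (x / 1 - y / 1)                 ≈⟨ toℚᵘ-homo-+ (x / 1) (- (y / 1)) ⟩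
    toℚᵘ (x / 1) ℚᵘ.+ toℚᵘ (- (y / 1))   ≈⟨ ℚᵘ.+-cong (toℚᵘ-fromℚᵘ (mkℚᵘ x 0))
                                              (ℚᵘ.≃-trans (toℚᵘ-homo‿- (y / 1)) (ℚᵘ.-‿cong (toℚᵘ-fromℚᵘ (mkℚᵘ y 0)))) ⟩
    mkℚᵘ x 0 ℚᵘ.+ ℚᵘ.- mkℚᵘ y 0          ≈⟨ *≡* (cross-multiplied x y) ⟩
    mkℚᵘ (x ℤ.- y) 0                     ≈⟨ ℚᵘ.≃-sym (toℚᵘ-fromℚᵘ (mkℚᵘ (x ℤ.- y) 0)) ⟩
    toℚᵘ ((x ℤ.- y) / 1)                 ∎)
    where
    cross-multiplied : ∀ x y → (x ℤ.* + 1 ℤ.+ (ℤ.- y) ℤ.* + 1) ℤ.* + 1 ≡ (x ℤ.- y) ℤ.* (+ 1 ℤ.* + 1)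
    cross-multiplied = ℤ-Solver.solve-∀

ratio-ℚ : ∀ (a b m k : ℕ) .{{_ : NonZero k}} → k * a ≡ m * b → + a / 1 ≡ (+ m / k) *ℚ (+ b / 1)
ratio-ℚ a b m k ka≡mb = /1-scale (+ a) (+ b) (+ m) k (trans (sym (pos-* k a)) (trans (cong +_ ka≡mb) (pos-* m b)))

difference-ℚ : ∀ (a b k : ℕ) .{{_ : NonZero k}} → k * a ≡ (k + 1) * b → + a / 1 - + b / 1 ≡ (+ 1 / k) *ℚ (+ b / 1)
difference-ℚ a b k ka≡[k+1]b = trans (/1-sub (+ a) (+ b)) (/1-scale (+ a ℤ.- + b) (+ b) (+ 1) k (rearranged (+ k) (+ a) (+ b) lifted))
  where
  lifted : + k ℤ.* + a ≡ (+ k ℤ.+ + 1) ℤ.* + b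
  lifted = trans (sym (pos-* k a)) (trans (cong +_ ka≡[k+1]b) (trans (pos-* (k + 1) b) (cong (ℤ._* + b) (pos-+ k 1))))
  rearranged : ∀ K A B → K ℤ.* A ≡ (K ℤ.+ + 1) ℤ.* B → K ℤ.* (A ℤ.- B) ≡ + 1 ℤ.* B
  rearranged K A B KA≡[K+1]B = trans (expand K A B) (trans (cong (ℤ._- K ℤ.* B) KA≡[K+1]B) (cancel K B))
    where
    expand : ∀ K A B → K ℤ.* (A ℤ.- B) ≡ K ℤ.* A ℤ.- K ℤ.* B
    expand = ℤ-Solver.solve-∀
    cancel : ∀ K B → (K ℤ.+ + 1) ℤ.* B ℤ.- K ℤ.* B ≡ + 1 ℤ.* B
    cancel = ℤ-Solver.solve-∀

shift-ℚ : ∀ (a b x d : ℕ) → a + d ≡ x + b → + a / 1 - + b / 1 ≡ + x / 1 - + d / 1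
shift-ℚ a b x d a+d≡x+b = trans (/1-sub (+ a) (+ b)) (trans (cong (λ z → z / 1) rearranged) (sym (/1-sub (+ x) (+ d))))
  where
  lifted : + a ℤ.+ + d ≡ + x ℤ.+ + b
  lifted = trans (sym (pos-+ a d)) (trans (cong +_ a+d≡x+b) (pos-+ x b))
  rearranged : + a ℤ.- + b ≡ + x ℤ.- + d
  rearranged = trans (add-both (+ a) (+ b) (+ d)) (trans (cong (ℤ._- (+ b ℤ.+ + d)) lifted) (cancel (+ x) (+ b) (+ d)))
    where
    add-both : ∀ A B D → A ℤ.- B ≡ (A ℤ.+ D) ℤ.- (B ℤ.+ D)
    add-both = ℤ-Solver.solve-∀
    cancel : ∀ X B D → (X ℤ.+ B) ℤ.- (B ℤ.+ D) ≡ X ℤ.- D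
    cancel = ℤ-Solver.solve-∀

open ≡-Reasoning

sumOver : {A : Set} → List A → (A → ℕ) → ℕ
sumOver []       f = 0
sumOver (x ∷ xs) f = f x + sumOver xs f

sumOver-++ : {A : Set} (xs ys : List A) (f : A → ℕ) → sumOver (xs ++ ys) f ≡ sumOver xs f + sumOver ys f
sumOver-++ []       ys f = refl
sumOver-++ (x ∷ xs) ys f = trans (cong (_+_ (f x)) (sumOver-++ xs ys f)) (sym (+-assoc (f x) _ _))

sumOver-cong : {A : Set} (xs : List A) {f g : A → ℕ} → (∀ x → f x ≡ g x) → sumOver xs f ≡ sumOver xs g
sumOver-cong []       f≡g = refl
sumOver-cong (x ∷ xs) f≡g = cong₂ _+_ (f≡g x) (sumOver-cong xs f≡g)

sumOver-zero : {A : Set} (xs : List A) → sumOver xs (λ _ → 0) ≡ 0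
sumOver-zero []       = refl
sumOver-zero (x ∷ xs) = sumOver-zero xs

sumOver-+ : {A : Set} (xs : List A) (f g : A → ℕ) → sumOver xs (λ x → f x + g x) ≡ sumOver xs f + sumOver xs g
sumOver-+ []       f g = refl
sumOver-+ (x ∷ xs) f g = trans (cong (_+_ (f x + g x)) (sumOver-+ xs f g)) (interchange (f x) (g x) _ _)
  where
  interchange : ∀ a b c d → a + b + (c + d) ≡ a + c + (b + d)
  interchange = ℕ-Solver.solve-∀

sumOver-map : {A B : Set} (h : A → B) (xs : List A) (f : B → ℕ) → sumOver (map h xs) f ≡ sumOver xs (λ x → f (h x))
sumOver-map h []       f = refl
sumOver-map h (x ∷ xs) f = cong (_+_ (f (h x))) (sumOver-map h xs f)

sumOver-concatMap : {A B : Set} (h : A → List B) (xs : List A) (f : B → ℕ) →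
                    sumOver (concatMap h xs) f ≡ sumOver xs (λ x → sumOver (h x) f)
sumOver-concatMap h []       f = refl
sumOver-concatMap h (x ∷ xs) f = trans (sumOver-++ (h x) _ f) (cong (_+_ (sumOver (h x) f)) (sumOver-concatMap h xs f))

sumOver-cartesianProduct : {A B : Set} (xs : List A) (ys : List B) (f : A × B → ℕ) →
  sumOver (cartesianProduct xs ys) f ≡ sumOver xs (λ x → sumOver ys (λ y → f (x , y)))
sumOver-cartesianProduct []       ys f = refl
sumOver-cartesianProduct (x ∷ xs) ys f = trans (sumOver-++ (map (x ,_) ys) _ f)
  (cong₂ _+_ (sumOver-map (x ,_) ys f) (sumOver-cartesianProduct xs ys f))

indicator : Bool → ℕ
indicator true  = 1
indicator false = 0

length-filterᵇ : {A : Set} (p : A → Bool) (xs : List A) → length (filterᵇ p xs) ≡ sumOver xs (λ x → indicator (p x))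
length-filterᵇ p []       = refl
length-filterᵇ p (x ∷ xs) with p x
... | true  = cong suc (length-filterᵇ p xs)
... | false = length-filterᵇ p xs

∑pairs : (n : ℕ) → (Vec Bool n → Vec Bool n → ℕ) → ℕ
∑pairs n g = sumOver (allRows n) (λ t → sumOver (allRows n) (λ u → g t u))

sumOver-allRows : (n : ℕ) (f : Vec Bool (suc n) → ℕ) →
  sumOver (allRows (suc n)) f ≡ sumOver (allRows n) (λ v → f (false ∷ v) + f (true ∷ v))
sumOver-allRows n f = trans (sumOver-concatMap _ (allRows n) f)
  (sumOver-cong (allRows n) (λ v → cong (_+_ (f (false ∷ v))) (+-identityʳ (f (true ∷ v)))))

∑pairs-cong : (n : ℕ) {f g : Vec Bool n → Vec Bool n → ℕ} → (∀ t u → f t u ≡ g t u) → ∑pairs n f ≡ ∑pairs n g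
∑pairs-cong n f≡g = sumOver-cong (allRows n) (λ t → sumOver-cong (allRows n) (f≡g t))

∑pairs-zero : (n : ℕ) → ∑pairs n (λ _ _ → 0) ≡ 0
∑pairs-zero n = trans (sumOver-cong (allRows n) (λ _ → sumOver-zero (allRows n))) (sumOver-zero (allRows n))

∑pairs-+ : (n : ℕ) (f g : Vec Bool n → Vec Bool n → ℕ) → ∑pairs n (λ t u → f t u + g t u) ≡ ∑pairs n f + ∑pairs n g
∑pairs-+ n f g = trans (sumOver-cong (allRows n) (λ t → sumOver-+ (allRows n) (f t) (g t))) (sumOver-+ (allRows n) _ _)

∑pairs-step : (n : ℕ) (g : Vec Bool (suc n) → Vec Bool (suc n) → ℕ) →
  ∑pairs (suc n) g ≡ ∑pairs n (λ t u → (g (false ∷ t) (false ∷ u) + g (false ∷ t) (true ∷ u))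
                                      + (g (true ∷ t) (false ∷ u) + g (true ∷ t) (true ∷ u)))
∑pairs-step n g = trans (sumOver-allRows n _)
  (sumOver-cong (allRows n) λ t → trans
    (cong₂ _+_ (sumOver-allRows n (g (false ∷ t))) (sumOver-allRows n (g (true ∷ t))))
    (sym (sumOver-+ (allRows n) _ _)))

rowAfter : {n : ℕ} → Bool → Vec Bool n → Bool
rowAfter p []      = true
rowAfter p (x ∷ t) = not (p ∧ x) ∧ rowAfter x t

rowAfter-noHorizAdj : {n : ℕ} (x : Bool) (t : Vec Bool n) → rowAfter x t ≡ noHorizAdj (x ∷ t)
rowAfter-noHorizAdj x []      = refl
rowAfter-noHorizAdj x (y ∷ t) = cong (not (x ∧ y) ∧_) (rowAfter-noHorizAdj y t)

rowAfter-false : {n : ℕ} (t : Vec Bool n) → rowAfter false t ≡ noHorizAdj t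
rowAfter-false []      = refl
rowAfter-false (x ∷ t) = rowAfter-noHorizAdj x t

-- It is defined column by column, which makes the first column computable.
compatible : {n : ℕ} → Bool → Bool → Vec Bool n → Vec Bool n → Bool
compatible p q []      []      = true
compatible p q (x ∷ t) (y ∷ u) = not (p ∧ x) ∧ not (q ∧ y) ∧ not (x ∧ y) ∧ compatible x y t u

compatible-rows : {n : ℕ} (p q : Bool) (t u : Vec Bool n) →
                  compatible p q t u ≡ rowAfter p t ∧ rowAfter q u ∧ noVertAdj t u
compatible-rows p q []      []      = refl
compatible-rows p q (x ∷ t) (y ∷ u) =
  trans (cong (λ b → not (p ∧ x) ∧ not (q ∧ y) ∧ not (x ∧ y) ∧ b) (compatible-rows x y t u))
        (regroup (not (p ∧ x)) (not (q ∧ y)) (not (x ∧ y)) (rowAfter x t) (rowAfter y u) (noVertAdj t u))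
  where
  regroup : ∀ a b c A B C → a ∧ b ∧ c ∧ (A ∧ B ∧ C) ≡ (a ∧ A) ∧ (b ∧ B) ∧ (c ∧ C)
  regroup = solve 6 (λ a b c A B C → a ⊕ b ⊕ c ⊕ (A ⊕ B ⊕ C) ⊜ (a ⊕ A) ⊕ (b ⊕ B) ⊕ (c ⊕ C)) refl

independent-compatible : {n : ℕ} (t u : Vec Bool n) → independent (t , u) ≡ compatible false false t u
independent-compatible t u = sym (trans (compatible-rows false false t u)
  (cong₂ (λ a b → a ∧ b ∧ noVertAdj t u) (rowAfter-false t) (rowAfter-false u)))

weight : {n : ℕ} → Bool → Bool → ℕ → Vec Bool n → Vec Bool n → ℕ
weight p q j t u = indicator (compatible p q t u ∧ (count t + count u ≡ᵇ j))

bounded : ℕ → Bool → Bool → ℕ → ℕ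
bounded n p q j = ∑pairs n (weight p q j)

T2-bounded : ∀ n j → T2 n j ≡ bounded n false false j
T2-bounded n j = trans (length-filterᵇ _ (allSelections n))
  (trans (sumOver-cartesianProduct (allRows n) (allRows n) _)
         (∑pairs-cong n (λ t u → cong (λ b → indicator (b ∧ (count t + count u ≡ᵇ j))) (independent-compatible t u))))

-- below f j = f (j - 1), and 0 when j = 0: the count left for the rest of the
-- grid after one square has been placed in the first column.
below : (ℕ → ℕ) → ℕ → ℕ
below f zero    = 0
below f (suc j) = f j

below-cong : {f g : ℕ → ℕ} → (∀ j → f j ≡ g j) → ∀ j → below f j ≡ below g j
below-cong f≡g zero    = refl
below-cong f≡g (suc j) = f≡g j

weight⁺ : {n : ℕ} → Bool → Bool → ℕ → Vec Bool n → Vec Bool n → ℕ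
weight⁺ p q j t u = indicator (compatible p q t u ∧ (suc (count t + count u) ≡ᵇ j))

bounded-below : ∀ n p q j → ∑pairs n (weight⁺ p q j) ≡ below (bounded n p q) j
bounded-below n p q zero    = trans (∑pairs-cong n (λ t u → cong indicator (∧-zeroʳ (compatible p q t u)))) (∑pairs-zero n)
bounded-below n p q (suc j) = refl

bottom-square : {n : ℕ} (b : Bool) (t u : Vec Bool n) (j : ℕ) →
                indicator (b ∧ (count t + suc (count u) ≡ᵇ j)) ≡ indicator (b ∧ (suc (count t + count u) ≡ᵇ j))
bottom-square b t u j = cong (λ m → indicator (b ∧ (m ≡ᵇ j))) (+-suc (count t) (count u))

-- After a free column every first column except
-- (true , true) is possible; after (true , false) only (false , false) and
-- (false , true); after (false , true) only (false , false) and (true , false).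

bounded-free : ∀ n j → bounded (suc n) false false j
  ≡ bounded n false false j + (below (bounded n false true) j + below (bounded n true false) j)
bounded-free n j = begin
  bounded (suc n) false false j
    ≡⟨ ∑pairs-step n (weight false false j) ⟩
  ∑pairs n (λ t u → (weight false false j t u + weight false false j (false ∷ t) (true ∷ u)) + (weight⁺ true false j t u + 0))
    ≡⟨ ∑pairs-cong n (λ t u → trans (cong (λ m → (weight false false j t u + m) + (weight⁺ true false j t u + 0))
                                            (bottom-square (compatible false true t u) t u j))
                                      (regroup (weight false false j t u) _ _)) ⟩
  ∑pairs n (λ t u → weight false false j t u + (weight⁺ false true j t u + weight⁺ true false j t u))
    ≡⟨ trans (∑pairs-+ n _ _) (cong (_+_ (bounded n false false j)) (∑pairs-+ n _ _)) ⟩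
  bounded n false false j + (∑pairs n (weight⁺ false true j) + ∑pairs n (weight⁺ true false j))
    ≡⟨ cong₂ (λ a b → bounded n false false j + (a + b)) (bounded-below n false true j) (bounded-below n true false j) ⟩
  bounded n false false j + (below (bounded n false true) j + below (bounded n true false) j) ∎
  where
  regroup : ∀ a b c → (a + b) + (c + 0) ≡ a + (b + c)
  regroup = ℕ-Solver.solve-∀

bounded-top : ∀ n j → bounded (suc n) true false j ≡ bounded n false false j + below (bounded n false true) j
bounded-top n j = begin
  bounded (suc n) true false j
    ≡⟨ ∑pairs-step n (weight true false j) ⟩
  ∑pairs n (λ t u → (weight false false j t u + weight true false j (false ∷ t) (true ∷ u)) + 0)
    ≡⟨ ∑pairs-cong n (λ t u → trans (+-identityʳ _) (cong (_+_ (weight false false j t u))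
                                      (bottom-square (compatible false true t u) t u j))) ⟩
  ∑pairs n (λ t u → weight false false j t u + weight⁺ false true j t u)
    ≡⟨ ∑pairs-+ n _ _ ⟩
  bounded n false false j + ∑pairs n (weight⁺ false true j)
    ≡⟨ cong (_+_ (bounded n false false j)) (bounded-below n false true j) ⟩
  bounded n false false j + below (bounded n false true) j ∎

bounded-bottom : ∀ n j → bounded (suc n) false true j ≡ bounded n false false j + below (bounded n true false) j
bounded-bottom n j = begin
  bounded (suc n) false true j
    ≡⟨ ∑pairs-step n (weight false true j) ⟩
  ∑pairs n (λ t u → (weight false false j t u + 0) + (weight⁺ true false j t u + 0))
    ≡⟨ ∑pairs-cong n (λ t u → cong₂ _+_ (+-identityʳ (weight false false j t u)) (+-identityʳ (weight⁺ true false j t u))) ⟩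
  ∑pairs n (λ t u → weight false false j t u + weight⁺ true false j t u)
    ≡⟨ ∑pairs-+ n _ _ ⟩
  bounded n false false j + ∑pairs n (weight⁺ true false j)
    ≡⟨ cong (_+_ (bounded n false false j)) (bounded-below n true false j) ⟩
  bounded n false false j + below (bounded n true false) j ∎

E : ℕ → ℕ → ℕ
E n j = bounded n false false j

X : ℕ → ℕ → ℕ
X n j = bounded n true false j

-- Forbidding the bottom instead of the top square gives the same count
-- (the two rows play symmetric roles).
bottom≡top : ∀ n j → bounded n false true j ≡ X n j
bottom≡top zero    j = refl
bottom≡top (suc n) j = begin
  bounded (suc n) false true j            ≡⟨ bounded-bottom n j ⟩
  E n j + below (X n) j                   ≡⟨ cong (_+_ (E n j)) (below-cong (λ i → sym (bottom≡top n i)) j) ⟩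
  E n j + below (bounded n false true) j  ≡⟨ sym (bounded-top n j) ⟩
  X (suc n) j                             ∎

E-rec : ∀ n j → E (suc n) j ≡ E n j + (below (X n) j + below (X n) j)
E-rec n j = trans (bounded-free n j) (cong (λ m → E n j + (m + below (X n) j)) (below-cong (bottom≡top n) j))

X-rec : ∀ n j → X (suc n) j ≡ E n j + below (X n) j
X-rec n j = trans (bounded-top n j) (cong (_+_ (E n j)) (below-cong (bottom≡top n) j))

E-zero : ∀ n → E n 0 ≡ 1
E-zero zero    = refl
E-zero (suc n) = trans (E-rec n 0) (trans (+-identityʳ (E n 0)) (E-zero n))

X-zero : ∀ n → X n 0 ≡ 1
X-zero zero    = refl
X-zero (suc n) = trans (X-rec n 0) (trans (+-identityʳ (E n 0)) (E-zero n))

E-X-above : ∀ n d → E n (suc n + d) ≡ 0 × X n (suc n + d) ≡ 0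
E-X-above zero    d = refl , refl
E-X-above (suc n) d = trans (E-rec n (suc (suc n + d))) (cong₂ (λ a b → a + (b + b)) E-above X-above)
                    , trans (X-rec n (suc (suc n + d))) (cong₂ _+_ E-above X-above)
  where
  E-above : E n (suc (suc n + d)) ≡ 0
  E-above = trans (cong (λ m → E n (suc m)) (sym (+-suc n d))) (proj₁ (E-X-above n (suc d)))
  X-above : X n (suc n + d) ≡ 0
  X-above = proj₂ (E-X-above n d)

E-above-diagonal : ∀ n → E n (suc n) ≡ 0
E-above-diagonal n = trans (cong (λ m → E n (suc m)) (sym (+-identityʳ n))) (proj₁ (E-X-above n 0))

-- With the top-left square forbidden, the only n-element set is the staircase.
X-diagonal : ∀ n → X n n ≡ 1
X-diagonal zero    = refl
X-diagonal (suc n) = trans (X-rec n (suc n)) (cong₂ _+_ (E-above-diagonal n) (X-diagonal n))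

-- The two staircases are the (n + 1)-element sets of the 2 × (n + 1) grid.
E-diagonal : ∀ n → E (suc n) (suc n) ≡ 2
E-diagonal n = trans (E-rec n (suc n)) (cong₂ (λ a b → a + (b + b)) (E-above-diagonal n) (X-diagonal n))

∑< : ℕ → (ℕ → ℕ) → ℕ
∑< zero    f = 0
∑< (suc N) f = f 0 + ∑< N (λ l → f (suc l))

∑<-cong : ∀ N {f g : ℕ → ℕ} → (∀ l → f l ≡ g l) → ∑< N f ≡ ∑< N g
∑<-cong zero    f≡g = refl
∑<-cong (suc N) f≡g = cong₂ _+_ (f≡g 0) (∑<-cong N (λ l → f≡g (suc l)))

∑<-+ : ∀ N (f g : ℕ → ℕ) → ∑< N (λ l → f l + g l) ≡ ∑< N f + ∑< N g
∑<-+ zero    f g = refl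
∑<-+ (suc N) f g = trans (cong (_+_ (f 0 + g 0)) (∑<-+ N (λ l → f (suc l)) (λ l → g (suc l))))
                         (interchange (f 0) (g 0) _ _)
  where
  interchange : ∀ a b c d → a + b + (c + d) ≡ a + c + (b + d)
  interchange = ℕ-Solver.solve-∀

∑<-* : ∀ N k (f : ℕ → ℕ) → ∑< N (λ l → k * f l) ≡ k * ∑< N f
∑<-* zero    k f = sym (*-zeroʳ k)
∑<-* (suc N) k f = trans (cong (_+_ (k * f 0)) (∑<-* N k (λ l → f (suc l)))) (sym (*-distribˡ-+ k (f 0) _))

∑<-zero : ∀ N {f : ℕ → ℕ} → (∀ l → f l ≡ 0) → ∑< N f ≡ 0
∑<-zero zero    f≡0 = refl
∑<-zero (suc N) f≡0 = cong₂ _+_ (f≡0 0) (∑<-zero N (λ l → f≡0 (suc l)))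

∑<-pad : ∀ N d (f : ℕ → ℕ) → (∀ l → f (N + l) ≡ 0) → ∑< (N + d) f ≡ ∑< N f
∑<-pad zero    d f f≡0 = ∑<-zero d f≡0
∑<-pad (suc N) d f f≡0 = cong (_+_ (f 0)) (∑<-pad N d (λ l → f (suc l)) f≡0)

∑<-drop-last : ∀ N (f : ℕ → ℕ) → f N ≡ 0 → ∑< (suc N) f ≡ ∑< N f
∑<-drop-last zero    f fN≡0 = trans (+-identityʳ _) fN≡0
∑<-drop-last (suc N) f fN≡0 = cong (_+_ (f 0)) (∑<-drop-last N (λ l → f (suc l)) fN≡0)

∑<-first : ∀ N (f : ℕ → ℕ) → (∀ l → f (suc l) ≡ 0) → ∑< (suc N) f ≡ f 0
∑<-first N f f≡0 = trans (cong (_+_ (f 0)) (∑<-zero N f≡0)) (+-identityʳ _)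

nC[1+n+l]≡0 : ∀ n l → n C (suc n + l) ≡ 0
nC[1+n+l]≡0 n l = k>n⇒nCk≡0 {n} {suc n + l} (s≤s (m≤m+n n l))

nC[1+n]≡0 : ∀ n → n C suc n ≡ 0
nC[1+n]≡0 n = k>n⇒nCk≡0 (n<1+n n)

pascal : ∀ n k → suc n C suc k ≡ n C k + n C suc k
pascal n k = sym (nCk+nC[k+1]≡[n+1]C[k+1] n k)

absorption : ∀ n k → suc n * (n C k) ≡ suc k * (suc n C suc k)
absorption n zero = begin
  suc n * (n C 0)      ≡⟨ *-identityʳ (suc n) ⟩
  suc n                ≡⟨ sym (nC1≡n (suc n)) ⟩
  suc n C 1            ≡⟨ sym (*-identityˡ (suc n C 1)) ⟩
  1 * (suc n C 1)      ∎
absorption zero (suc k) = begin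
  1 * (0 C suc k)               ≡⟨ cong (1 *_) (k>n⇒nCk≡0 {0} {suc k} (s≤s z≤n)) ⟩
  0                             ≡⟨ sym (*-zeroʳ (suc (suc k))) ⟩
  suc (suc k) * 0               ≡⟨ cong (suc (suc k) *_) (sym (k>n⇒nCk≡0 {1} {suc (suc k)} (s≤s (s≤s z≤n)))) ⟩
  suc (suc k) * (1 C suc (suc k)) ∎
absorption (suc n) (suc k) = begin
  suc (suc n) * P                   ≡⟨ cong (λ m → P + suc n * m) (pascal n k) ⟩
  P + suc n * (n C k + n C suc k)   ≡⟨ cong (_+_ P) (*-distribˡ-+ (suc n) (n C k) (n C suc k)) ⟩
  P + (suc n * (n C k) + suc n * (n C suc k))
                                    ≡⟨ cong₂ (λ a b → P + (a + b)) (absorption n k) (absorption n (suc k)) ⟩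
  P + (suc k * P + suc (suc k) * Q) ≡⟨ collect k P Q ⟩
  suc (suc k) * (P + Q)             ≡⟨ cong (suc (suc k) *_) (sym (pascal (suc n) (suc k))) ⟩
  suc (suc k) * (suc (suc n) C suc (suc k)) ∎
  where
  P Q : ℕ
  P = suc n C suc k
  Q = suc n C suc (suc k)
  collect : ∀ k P Q → P + (suc k * P + suc (suc k) * Q) ≡ suc (suc k) * (P + Q)
  collect = ℕ-Solver.solve-∀

delannoy : ℕ → ℕ → ℕ
delannoy a b = ∑< (suc a) (λ l → 2 ^ l * (a C l) * (b C l))

companion : ℕ → ℕ → ℕ
companion c b = ∑< (suc c) (λ l → 2 ^ suc l * (c C l) * (suc b C suc l))

-- Boundary values: only the l = 0 term survives.
delannoy-zeroʳ : ∀ a → delannoy a 0 ≡ 1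
delannoy-zeroʳ a = ∑<-first a term (λ l → trans (cong (2 ^ suc l * (a C suc l) *_) (k>n⇒nCk≡0 {0} {suc l} (s≤s z≤n)))
                                                (*-zeroʳ (2 ^ suc l * (a C suc l))))
  where
  term : ℕ → ℕ
  term l = 2 ^ l * (a C l) * (0 C l)

companion-zero : ∀ c → companion c 0 ≡ 2
companion-zero c = ∑<-first c term (λ l → trans (cong (2 ^ suc (suc l) * (c C suc l) *_) (k>n⇒nCk≡0 {1} {suc (suc l)} (s≤s (s≤s z≤n))))
                                                 (*-zeroʳ (2 ^ suc (suc l) * (c C suc l))))
  where
  term : ℕ → ℕ
  term l = 2 ^ suc l * (c C l) * (1 C suc l)

delannoy-rec : ∀ c b → delannoy (suc c) (suc b) ≡ companion c b + delannoy c (suc b)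
delannoy-rec c b = begin
  delannoy (suc c) (suc b)
    ≡⟨ cong suc (∑<-cong (suc c) (λ l → split (2 ^ suc l) (c C l) (c C suc l) (suc b C suc l) (pascal c l))) ⟩
  1 + ∑< (suc c) (λ l → g l + h l)
    ≡⟨ cong suc (trans (∑<-+ (suc c) g h) (cong (_+_ (companion c b)) (∑<-drop-last c h h-last))) ⟩
  1 + (companion c b + ∑< c h)
    ≡⟨ sym (+-suc (companion c b) (∑< c h)) ⟩
  companion c b + (1 + ∑< c h)
    ≡⟨⟩
  companion c b + delannoy c (suc b) ∎
  where
  g h : ℕ → ℕ
  g l = 2 ^ suc l * (c C l) * (suc b C suc l)
  h l = 2 ^ suc l * (c C suc l) * (suc b C suc l)
  h-last : h c ≡ 0
  h-last = trans (cong (λ x → 2 ^ suc c * x * (suc b C suc c)) (nC[1+n]≡0 c)) (cong (_* (suc b C suc c)) (*-zeroʳ (2 ^ suc c)))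
  split : ∀ P x y z {w} → w ≡ x + y → P * w * z ≡ P * x * z + P * y * z
  split P x y z refl = distrib P x y z
    where
    distrib : ∀ P x y z → P * (x + y) * z ≡ P * x * z + P * y * z
    distrib = ℕ-Solver.solve-∀

companion-rec : ∀ c b → companion c (suc b) ≡ companion c b + (delannoy c (suc b) + delannoy c (suc b))
companion-rec c b = begin
  companion c (suc b)
    ≡⟨ ∑<-cong (suc c) (λ l → split (2 ^ l) (c C l) (suc b C l) (suc b C suc l) (pascal (suc b) l)) ⟩
  ∑< (suc c) (λ l → g l + (d l + d l))
    ≡⟨ trans (∑<-+ (suc c) g (λ l → d l + d l)) (cong (_+_ (companion c b)) (∑<-+ (suc c) d d)) ⟩
  companion c b + (delannoy c (suc b) + delannoy c (suc b)) ∎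
  where
  g d : ℕ → ℕ
  g l = 2 ^ suc l * (c C l) * (suc b C suc l)
  d l = 2 ^ l * (c C l) * (suc b C l)
  split : ∀ P p x y {w} → w ≡ x + y → (2 * P) * p * w ≡ (2 * P) * p * y + (P * p * x + P * p * x)
  split P p x y refl = distrib P p x y
    where
    distrib : ∀ P p x y → (2 * P) * p * (x + y) ≡ (2 * P) * p * y + (P * p * x + P * p * x)
    distrib = ℕ-Solver.solve-∀

-- (c + 1) G(c, c + 1) = (c + 2) G(c + 1, c), by absorption applied termwise.
companion-absorption : ∀ c → suc c * companion c (suc c) ≡ suc (suc c) * companion (suc c) c
companion-absorption c = begin
  suc c * companion c (suc c)                 ≡⟨ sym (∑<-* (suc c) (suc c) f) ⟩
  ∑< (suc c) (λ l → suc c * f l)              ≡⟨ ∑<-cong (suc c) termwise ⟩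
  ∑< (suc c) (λ l → suc (suc c) * g l)        ≡⟨ ∑<-* (suc c) (suc (suc c)) g ⟩
  suc (suc c) * ∑< (suc c) g                  ≡⟨ cong (suc (suc c) *_) (sym (∑<-drop-last (suc c) g g-last)) ⟩
  suc (suc c) * companion (suc c) c           ∎
  where
  f g : ℕ → ℕ
  f l = 2 ^ suc l * (c C l) * (suc (suc c) C suc l)
  g l = 2 ^ suc l * (suc c C l) * (suc c C suc l)
  g-last : g (suc c) ≡ 0
  g-last = trans (cong (2 ^ suc (suc c) * (suc c C suc c) *_) (nC[1+n]≡0 (suc c))) (*-zeroʳ (2 ^ suc (suc c) * (suc c C suc c)))
  termwise : ∀ l → suc c * f l ≡ suc (suc c) * g l
  termwise l = begin
    suc c * (P * (c C l) * Y)                    ≡⟨ inward (suc c) P (c C l) Y ⟩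
    P * (suc c * (c C l)) * Y                    ≡⟨ cong (λ x → P * x * Y) (absorption c l) ⟩
    P * (suc l * Z) * Y                          ≡⟨ swap P (suc l) Z Y ⟩
    P * (suc l * Y) * Z                          ≡⟨ cong (λ x → P * x * Z) (sym (absorption (suc c) l)) ⟩
    P * (suc (suc c) * (suc c C l)) * Z          ≡⟨ sym (inward (suc (suc c)) P (suc c C l) Z) ⟩
    suc (suc c) * (P * (suc c C l) * Z)          ∎
    where
    P Y Z : ℕ
    P = 2 ^ suc l
    Y = suc (suc c) C suc l
    Z = suc c C suc l
    inward : ∀ k P x Y → k * (P * x * Y) ≡ P * (k * x) * Y
    inward = ℕ-Solver.solve-∀
    swap : ∀ P s Z Y → P * (s * Z) * Y ≡ P * (s * Y) * Z
    swap = ℕ-Solver.solve-∀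

delannoy-symmetric : ∀ a d → delannoy a (d + a) ≡ delannoy (d + a) a
delannoy-symmetric a d = sym (begin
  delannoy (d + a) a                  ≡⟨ cong (λ N → ∑< (suc N) f) (+-comm d a) ⟩
  ∑< (suc a + d) f                    ≡⟨ ∑<-pad (suc a) d f f-beyond ⟩
  ∑< (suc a) f                        ≡⟨ ∑<-cong (suc a) (λ l → swap (2 ^ l) ((d + a) C l) (a C l)) ⟩
  delannoy a (d + a)                  ∎)
  where
  f : ℕ → ℕ
  f l = 2 ^ l * ((d + a) C l) * (a C l)
  f-beyond : ∀ l → f (suc a + l) ≡ 0
  f-beyond l = trans (cong (2 ^ (suc a + l) * ((d + a) C (suc a + l)) *_) (nC[1+n+l]≡0 a l)) (*-zeroʳ (2 ^ (suc a + l) * ((d + a) C (suc a + l))))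
  swap : ∀ P x y → P * x * y ≡ P * y * x
  swap = ℕ-Solver.solve-∀

mutual
  X-delannoy : ∀ a b → X (a + b) a ≡ delannoy a b
  X-delannoy a       zero    = trans (cong (λ n → X n a) (+-identityʳ a)) (trans (X-diagonal a) (sym (delannoy-zeroʳ a)))
  X-delannoy zero    (suc b) = X-zero (suc b)
  X-delannoy (suc c) (suc b) = begin
    X (suc (c + suc b)) (suc c)               ≡⟨ X-rec (c + suc b) (suc c) ⟩
    E (c + suc b) (suc c) + X (c + suc b) c   ≡⟨ cong₂ _+_ (trans (cong (λ n → E n (suc c)) (+-suc c b)) (E-companion c b))
                                                           (X-delannoy c (suc b)) ⟩
    companion c b + delannoy c (suc b)        ≡⟨ sym (delannoy-rec c b) ⟩
    delannoy (suc c) (suc b)                  ∎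

  E-companion : ∀ c b → E (suc c + b) (suc c) ≡ companion c b
  E-companion c zero    = trans (cong (λ n → E (suc n) (suc c)) (+-identityʳ c)) (trans (E-diagonal c) (sym (companion-zero c)))
  E-companion c (suc b) = begin
    E (suc c + suc b) (suc c)                                      ≡⟨ cong (λ n → E (suc n) (suc c)) (+-suc c b) ⟩
    E (suc (suc c + b)) (suc c)                                    ≡⟨ E-rec (suc c + b) (suc c) ⟩
    E (suc c + b) (suc c) + (X (suc c + b) c + X (suc c + b) c)   ≡⟨ cong₂ (λ e x → e + (x + x)) (E-companion c b) X-value ⟩
    companion c b + (delannoy c (suc b) + delannoy c (suc b))      ≡⟨ sym (companion-rec c b) ⟩
    companion c (suc b)                                            ∎
    where
    X-value : X (suc c + b) c ≡ delannoy c (suc b)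
    X-value = trans (cong (λ n → X n c) (sym (+-suc c b))) (X-delannoy c (suc b))

T2-central : ∀ c → T2 (2 * suc c) (suc c) ≡ companion c (suc c)
T2-central c = trans (T2-bounded (2 * suc c) (suc c))
                     (trans (cong (λ n → E n (suc c)) (cong (_+_ (suc c)) (+-identityʳ (suc c)))) (E-companion c (suc c)))

T2-central⁺ : ∀ c → T2 (2 * suc c) (suc c + 1) ≡ companion (suc c) c
T2-central⁺ c = trans (T2-bounded (2 * suc c) (suc c + 1))
                      (trans (cong₂ E two-k≡[k+1]+[k-1] (+-comm (suc c) 1)) (E-companion (suc c) c))
  where
  two-k≡[k+1]+[k-1] : 2 * suc c ≡ suc (suc c) + c
  two-k≡[k+1]+[k-1] = cong suc (trans (+-suc c (c + 0)) (cong (λ n → suc (c + n)) (+-identityʳ c)))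

central-ratio : ∀ k → 1 ≤ k → k * T2 (2 * k) k ≡ (k + 1) * T2 (2 * k) (k + 1)
central-ratio (suc c) _ = begin
  suc c * T2 (2 * suc c) (suc c)            ≡⟨ cong (suc c *_) (T2-central c) ⟩
  suc c * companion c (suc c)               ≡⟨ companion-absorption c ⟩
  suc (suc c) * companion (suc c) c         ≡⟨ cong₂ _*_ (+-comm 1 (suc c)) (sym (T2-central⁺ c)) ⟩
  (suc c + 1) * T2 (2 * suc c) (suc c + 1)  ∎

-- Part (3) over ℕ: T(2,2k;k) + T(2,2k-1;k+1) = T(2,2k-1;k) + T(2,2k;k+1).
-- With m = 2k - 1, both sides equal E m k + E m (k+1) + 2 X m (k-1) = ... + 2 X m k.
central-difference : ∀ k → 1 ≤ k → T2 (2 * k) k + T2 (2 * k ∸ 1) (k + 1) ≡ T2 (2 * k ∸ 1) k + T2 (2 * k) (k + 1)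
central-difference (suc c) _ = begin
  T2 (suc m) (suc c) + T2 m (suc c + 1)
    ≡⟨ cong₂ _+_ (T2-bounded (suc m) (suc c)) (trans (T2-bounded m (suc c + 1)) (cong (E m) (+-comm (suc c) 1))) ⟩
  E (suc m) (suc c) + E m (suc (suc c))
    ≡⟨ cong (_+ E m (suc (suc c))) (E-rec m (suc c)) ⟩
  E m (suc c) + (X m c + X m c) + E m (suc (suc c))
    ≡⟨ cong (λ x → E m (suc c) + (x + x) + E m (suc (suc c))) X-middle ⟩
  E m (suc c) + (X m (suc c) + X m (suc c)) + E m (suc (suc c))
    ≡⟨ regroup (E m (suc c)) (X m (suc c) + X m (suc c)) (E m (suc (suc c))) ⟩
  E m (suc c) + (E m (suc (suc c)) + (X m (suc c) + X m (suc c)))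
    ≡⟨ cong (_+_ (E m (suc c))) (sym (E-rec m (suc (suc c)))) ⟩
  E m (suc c) + E (suc m) (suc (suc c))
    ≡⟨ sym (cong₂ _+_ (T2-bounded m (suc c)) (trans (T2-bounded (suc m) (suc c + 1)) (cong (E (suc m)) (+-comm (suc c) 1)))) ⟩
  T2 m (suc c) + T2 (suc m) (suc c + 1)
    ∎
  where
  m : ℕ
  m = 2 * suc c ∸ 1
  X-middle : X m c ≡ X m (suc c)
  X-middle = begin
    X m c                    ≡⟨ cong (λ n → X (c + suc n) c) (+-identityʳ c) ⟩
    X (c + suc c) c          ≡⟨ X-delannoy c (suc c) ⟩
    delannoy c (suc c)       ≡⟨ delannoy-symmetric c 1 ⟩
    delannoy (suc c) c       ≡⟨ sym (X-delannoy (suc c) c) ⟩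
    X (suc c + c) (suc c)    ≡⟨ cong (λ n → X n (suc c)) (sym (trans (cong (λ n → c + suc n) (+-identityʳ c)) (+-suc c c))) ⟩
    X m (suc c)              ∎
  regroup : ∀ e y f → e + y + f ≡ e + (f + y)
  regroup = ℕ-Solver.solve-∀

proposition18 : (k : ℕ) → (hk : 1 ≤ k) →
    let instance _ = >-nonZero hk
        T : ℕ → ℕ → ℚ
        T n j = (+ T2 n j) / 1
    in ((T (2 * k) k ≡ ((+ (k + 1)) / k) *ℚ T (2 * k) (k + 1))
       × (T (2 * k) k - T (2 * k) (k + 1) ≡ ((+ 1) / k) *ℚ T (2 * k) (k + 1)))
       × (T (2 * k) k - T (2 * k) (k + 1) ≡ T (2 * k ∸ 1) k - T (2 * k ∸ 1) (k + 1))
proposition18 k hk =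
  ( ratio-ℚ a b (k + 1) k (central-ratio k hk)
  , difference-ℚ a b k (central-ratio k hk) )
  , shift-ℚ a b x d (central-difference k hk)
  where
  instance
    k≢0 : NonZero k
    k≢0 = >-nonZero hk
  a b x d : ℕ
  a = T2 (2 * k) k
  b = T2 (2 * k) (k + 1)
  x = T2 (2 * k ∸ 1) k
  d = T2 (2 * k ∸ 1) (k + 1)
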